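{- Let $F$ be a finite field and $n\ge2$ an integer, and assume $-I_n\in SL_n(F)$. Then the Cayley graph $\Gamma(M_n(F),SL_n(F))$ is connected.
   Context: The Cayley graph $\Gamma(R,S)$ has vertex set $R$, with $a,b$ adjacent iff $a-b\in S$ (an undirected graph when $S=-S$, which here is guaranteed by $-I_n\in SL_n(F)$, i.e. $\mathrm{char}F=2$ or $n$ even). -}

module Defs where

open import Level using (Level; _⊔_)
open import Data.Nat using (ℕ; zero; suc)
open import Data.Fin using (Fin; zero; suc; punchIn)
import Data.Fin
import Relation.Nullary
open import Data.Product using (∃; _×_)
open import Relation.Nullary using (¬_)
open import Relation.Binary.Construct.Closure.ReflexiveTransitive using (Star)
open import Algebra.Bundles using (CommutativeRing)

record IsField {c ℓ : Level} (R : CommutativeRing c ℓ) : Set (c ⊔ ℓ) where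
  open CommutativeRing R hiding (zero)
  field
    1≉0     : ¬ (1# ≈ 0#)
    inverse : ∀ x → ¬ (x ≈ 0#) → ∃ λ y → x * y ≈ 1#

IsFinite : {c ℓ : Level} (R : CommutativeRing c ℓ) → Set (c ⊔ ℓ)
IsFinite R = ∃ λ k → ∃ λ (f : Fin k → Carrier) → ∀ x → ∃ λ i → f i ≈ x
  where open CommutativeRing R

module MatrixDefs {c ℓ : Level} (R : CommutativeRing c ℓ) where
  open CommutativeRing R hiding (zero)

  Mat : ℕ → Set c
  Mat n = Fin n → Fin n → Carrier

  sumF : ∀ {n} → (Fin n → Carrier) → Carrier
  sumF {zero}  f = 0#
  sumF {suc n} f = f zero + sumF (λ i → f (suc i))

  sgn : ∀ {n} → Fin n → Carrier
  sgn zero    = 1#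
  sgn (suc j) = - sgn j

  minor : ∀ {n} → Mat (suc n) → Fin (suc n) → Mat n
  minor A j r s = A (suc r) (punchIn j s)

  det : ∀ {n} → Mat n → Carrier
  det {zero}  A = 1#
  det {suc n} A = sumF (λ j → sgn j * (A zero j * det (minor A j)))

  _-M_ : ∀ {n} → Mat n → Mat n → Mat n
  (A -M B) i j = A i j - B i j

  negI : ∀ {n} → Mat n
  negI i j with Data.Fin._≟_ i j
  ... | Relation.Nullary.yes _ = - 1#
  ... | Relation.Nullary.no _  = 0#

  InSL : ∀ {n} → Mat n → Set ℓ
  InSL A = det A ≈ 1#

  CayleyAdj : ∀ n → Mat n → Mat n → Set ℓ
  CayleyAdj n A B = InSL (A -M B)

  CayleyConnected : ℕ → Set (c ⊔ ℓ)
  CayleyConnected n = ∀ (A B : Mat n) → Star (CayleyAdj n) A B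

{-# OPTIONS --safe #-}
-- For n ≥ 2 every n × n matrix over a commutative ring is a finite sum of
-- matrices of determinant 1, and subtracting the summands of A - B one at a
-- time walks from A to B along edges of the Cayley graph.
--
-- The twist [[a, 1], [-1, 0]] ⊕ I and
-- the two unitriangular shears have determinant 1, and as a and the shears'
-- off-diagonal vectors vary, their sum runs through all matrices with a fixed
-- lower-right block W. It therefore suffices to find, for every (n-1) × (n-1)
-- matrix Y, some sum of SL matrices with lower-right block Y. For n > 2 write
-- Y as a sum of SL matrices S by induction and border each S as 1 ⊕ S; for
-- n = 2 the twist [[0, 1], [-1, y]] does it.
module Submission where

open import Defs
open import Data.Nat using (ℕ; zero; suc; _≥_; s≤s; z≤n)
open import Data.Fin using (Fin; zero; suc; punchIn)
open import Data.Product using (∃; _,_; map₂; zip)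
open import Function using (_∘_)
open import Level using (_⊔_)
open import Algebra.Bundles using (CommutativeRing)
open import Relation.Binary.Construct.Closure.ReflexiveTransitive using (Star; ε; _◅_; _◅◅_)

module _ {c ℓ} (R : CommutativeRing c ℓ) where
  open CommutativeRing R hiding (zero)
  open MatrixDefs R
  open import Algebra.Properties.Ring ring
    using (-1*x≈-x; -‿involutive; //-rightDividesˡ; //-rightDividesʳ; \\-leftDividesˡ)
  open import Relation.Binary.Reasoning.Setoid setoid

  infix  4 _≋_
  infixl 6 _+M_

  _≋_ : ∀ {n} → Mat n → Mat n → Set ℓ
  A ≋ B = ∀ i j → A i j ≈ B i j

  _+M_ : ∀ {n} → Mat n → Mat n → Mat n
  (A +M B) i j = A i j + B i j

  0ᵥ : ∀ {n} → Fin n → Carrier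
  0ᵥ _ = 0#

  e₀ : ∀ {n} → Fin (suc n) → Carrier
  e₀ zero    = 1#
  e₀ (suc _) = 0#

  border : ∀ {n} → Carrier → (Fin n → Carrier) → (Fin n → Carrier) → Mat n → Mat (suc n)
  border a u v X zero    zero    = a
  border a u v X zero    (suc j) = u j
  border a u v X (suc i) zero    = v i
  border a u v X (suc i) (suc j) = X i j

  1M : ∀ {n} → Mat n
  1M {zero}  = λ ()
  1M {suc n} = border 1# 0ᵥ 0ᵥ 1M

  sumF-cong : ∀ {n} {f g : Fin n → Carrier} → (∀ i → f i ≈ g i) → sumF f ≈ sumF g
  sumF-cong {zero}  _   = refl
  sumF-cong {suc n} f≈g = +-cong (f≈g zero) (sumF-cong (f≈g ∘ suc))

  sumF-zero : ∀ {n} {f : Fin n → Carrier} → (∀ i → f i ≈ 0#) → sumF f ≈ 0#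
  sumF-zero {zero}  _   = refl
  sumF-zero {suc n} f≈0 = trans (+-cong (f≈0 zero) (sumF-zero (f≈0 ∘ suc))) (+-identityʳ 0#)

  det-cong : ∀ {n} {A B : Mat n} → A ≋ B → det A ≈ det B
  det-cong {zero}  _   = refl
  det-cong {suc n} A≋B =
    sumF-cong λ j → *-congˡ {sgn j} (*-cong (A≋B zero j) (det-cong λ r s → A≋B (suc r) (punchIn j s)))

  term≈0-entry : ∀ {s x d} → x ≈ 0# → s * (x * d) ≈ 0#
  term≈0-entry {s} {x} {d} x≈0 = trans (*-congˡ (trans (*-congʳ x≈0) (zeroˡ d))) (zeroʳ s)

  term≈0-minor : ∀ {s x d} → d ≈ 0# → s * (x * d) ≈ 0#
  term≈0-minor {s} {x} {d} d≈0 = trans (*-congˡ (trans (*-congˡ d≈0) (zeroʳ x))) (zeroʳ s)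

  det-firstTerm : ∀ {n} (A : Mat (suc n)) →
                  (∀ j → sgn (suc j) * (A zero (suc j) * det (minor A (suc j))) ≈ 0#) →
                  det A ≈ A zero zero * det (minor A zero)
  det-firstTerm A others≈0 = trans (+-cong (*-identityˡ _) (sumF-zero others≈0)) (+-identityʳ _)

  det-rowHead : ∀ {n} (A : Mat (suc n)) → (∀ j → A zero (suc j) ≈ 0#) →
                det A ≈ A zero zero * det (minor A zero)
  det-rowHead A row≈0 = det-firstTerm A (term≈0-entry ∘ row≈0)

  mutual
    det-zeroColumn : ∀ {n} (A : Mat (suc n)) → (∀ i → A i zero ≈ 0#) → det A ≈ 0#
    det-zeroColumn A col≈0 = begin
      det A                            ≈⟨ det-firstTerm A (term≈0-minor ∘ det-minor-suc≈0 A (col≈0 ∘ suc)) ⟩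
      A zero zero * det (minor A zero) ≈⟨ *-congʳ (col≈0 zero) ⟩
      0# * det (minor A zero)          ≈⟨ zeroˡ _ ⟩
      0#                               ∎

    det-minor-suc≈0 : ∀ {n} (A : Mat (suc n)) → (∀ i → A (suc i) zero ≈ 0#) →
                      ∀ j → det (minor A (suc j)) ≈ 0#
    det-minor-suc≈0 {suc n} A col≈0 j = det-zeroColumn (minor A (suc j)) col≈0

  det-colHead : ∀ {n} (A : Mat (suc n)) → (∀ i → A (suc i) zero ≈ 0#) →
                det A ≈ A zero zero * det (minor A zero)
  det-colHead A col≈0 = det-firstTerm A (term≈0-minor ∘ det-minor-suc≈0 A col≈0)

  det-1M : ∀ {n} → det (1M {n}) ≈ 1#
  det-1M {zero}  = refl
  det-1M {suc n} = trans (det-rowHead (1M {suc n}) (λ _ → refl)) (trans (*-identityˡ _) (det-1M {n}))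

  lowerShear : ∀ {n} → (Fin n → Carrier) → Mat (suc n)
  lowerShear v = border 1# 0ᵥ v 1M

  upperShear : ∀ {n} → (Fin n → Carrier) → Mat (suc n)
  upperShear u = border 1# u 0ᵥ 1M

  -- [[a, 1], [-1, b]] ⊕ I, of determinant ab + 1
  twist : ∀ {n} → Carrier → Carrier → Mat (suc (suc n))
  twist a b = border a e₀ (-_ ∘ e₀) (border b 0ᵥ 0ᵥ 1M)

  lowerShear-inSL : ∀ {n} (v : Fin n → Carrier) → InSL (lowerShear v)
  lowerShear-inSL {n} v =
    trans (det-rowHead (lowerShear v) (λ _ → refl)) (trans (*-identityˡ _) (det-1M {n}))

  upperShear-inSL : ∀ {n} (u : Fin n → Carrier) → InSL (upperShear u)
  upperShear-inSL {n} u =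
    trans (det-colHead (upperShear u) (λ _ → refl)) (trans (*-identityˡ _) (det-1M {n}))

  twist-inSL : ∀ {n} {a b} → a * b ≈ 0# → InSL (twist {n} a b)
  twist-inSL {n} {a} {b} ab≈0 = begin
    det (twist {n} a b)
      ≈⟨ +-cong (*-congˡ (*-congˡ det-corner))
                (+-cong (*-congˡ (*-congˡ det-minor₁)) (sumF-zero {n} λ _ → term≈0-entry refl)) ⟩
    1# * (a * b) + (- 1# * (1# * - 1#) + 0#)
      ≈⟨ +-cong (trans (*-identityˡ _) ab≈0) (trans (+-identityʳ _) -1*[1*-1]≈1) ⟩
    0# + 1#
      ≈⟨ +-identityˡ 1# ⟩
    1# ∎
    where
    det-corner : det (border b 0ᵥ 0ᵥ (1M {n})) ≈ b
    det-corner = trans (det-rowHead (border b 0ᵥ 0ᵥ (1M {n})) (λ _ → refl))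
                       (trans (*-congˡ (det-1M {n})) (*-identityʳ b))

    det-minor₁ : det (minor (twist {n} a b) (suc zero)) ≈ - 1#
    det-minor₁ = trans (det-rowHead (minor (twist {n} a b) (suc zero)) (λ _ → refl))
                       (trans (*-congˡ (det-1M {n})) (*-identityʳ _))

    -1*[1*-1]≈1 : - 1# * (1# * - 1#) ≈ 1#
    -1*[1*-1]≈1 = trans (-1*x≈-x _) (trans (-‿cong (*-identityˡ _)) (-‿involutive 1#))

  data IsSumOfSL {n} : Mat n → Set (c ⊔ ℓ) where
    sl   : ∀ {S} → InSL S → IsSumOfSL S
    _⊞_  : ∀ {A B} → IsSumOfSL A → IsSumOfSL B → IsSumOfSL (A +M B)
    resp : ∀ {A B} → A ≋ B → IsSumOfSL A → IsSumOfSL B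

  walk : ∀ {n} {D A B : Mat n} → IsSumOfSL D → A ≋ D +M B → Star (CayleyAdj n) A B
  walk (sl detS≈1) A≋S+B =
    trans (det-cong λ i j → trans (+-congʳ (A≋S+B i j)) (//-rightDividesʳ _ _)) detS≈1 ◅ ε
  walk (p ⊞ q) A≋[E+F]+B =
    walk p (λ i j → trans (A≋[E+F]+B i j) (+-assoc _ _ _)) ◅◅ walk q (λ _ _ → refl)
  walk (resp C≋D p) A≋D+B = walk p (λ i j → trans (A≋D+B i j) (+-congʳ (sym (C≋D i j))))

  isSumOfSL-blockDiag : ∀ {n} {Y : Mat n} → IsSumOfSL Y → ∃ λ e → IsSumOfSL (border e 0ᵥ 0ᵥ Y)
  isSumOfSL-blockDiag (sl {S} detS≈1) =
    1# , sl (trans (det-rowHead (border 1# 0ᵥ 0ᵥ S) (λ _ → refl)) (trans (*-identityˡ _) detS≈1))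
  isSumOfSL-blockDiag (p ⊞ q) =
    zip _+_ (λ p′ q′ → resp border-+M (p′ ⊞ q′)) (isSumOfSL-blockDiag p) (isSumOfSL-blockDiag q)
    where
    border-+M : ∀ {n e f} {X Y : Mat n} →
                border e 0ᵥ 0ᵥ X +M border f 0ᵥ 0ᵥ Y ≋ border (e + f) 0ᵥ 0ᵥ (X +M Y)
    border-+M zero    zero    = refl
    border-+M zero    (suc j) = +-identityʳ 0#
    border-+M (suc i) zero    = +-identityʳ 0#
    border-+M (suc i) (suc j) = refl
  isSumOfSL-blockDiag (resp X≋Y p) = map₂ (resp border-cong) (isSumOfSL-blockDiag p)
    where
    border-cong : ∀ {e} → border e 0ᵥ 0ᵥ _ ≋ border e 0ᵥ 0ᵥ _
    border-cong zero    zero    = refl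
    border-cong zero    (suc j) = refl
    border-cong (suc i) zero    = refl
    border-cong (suc i) (suc j) = X≋Y i j

  IsBlockOfSLSum : ∀ {n} → Mat n → Set (c ⊔ ℓ)
  IsBlockOfSLSum Y = ∃ λ a → ∃ λ u → ∃ λ v → IsSumOfSL (border a u v Y)

  isBlockOfSLSum-1 : (Y : Mat 1) → IsBlockOfSLSum Y
  isBlockOfSLSum-1 Y = 0# , e₀ , -_ ∘ e₀ , resp twist≋ (sl (twist-inSL {0} (zeroˡ (Y zero zero))))
    where
    twist≋ : twist 0# (Y zero zero) ≋ border 0# e₀ (-_ ∘ e₀) Y
    twist≋ zero       zero       = refl
    twist≋ zero       (suc zero) = refl
    twist≋ (suc zero) zero       = refl
    twist≋ (suc zero) (suc zero) = refl

  -- the lower-right block of twist a 0# +M (lowerShear v +M upperShear u)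
  W : ∀ {n} → Mat (suc n)
  W = border 0# 0ᵥ 0ᵥ 1M +M (1M +M 1M)

  isSumOfSL-border-W : ∀ {n} a u v → IsSumOfSL (border {suc n} a u v W)
  isSumOfSL-border-W {n} a u v =
    resp entries
      (sl (twist-inSL {n} (zeroʳ a′)) ⊞ (sl (lowerShear-inSL v′) ⊞ sl (upperShear-inSL u′)))
    where
    a′ : Carrier
    a′ = a - (1# + 1#)
    u′ v′ : Fin (suc n) → Carrier
    u′ j = - e₀ j + u j
    v′ i = - (- e₀ i) + v i
    entries : twist a′ 0# +M (lowerShear v′ +M upperShear u′) ≋ border a u v W
    entries zero    zero    = //-rightDividesˡ (1# + 1#) a
    entries zero    (suc j) = trans (+-congˡ (+-identityˡ _)) (\\-leftDividesˡ (e₀ j) (u j))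
    entries (suc i) zero    = trans (+-congˡ (+-identityʳ _)) (\\-leftDividesˡ (- e₀ i) (v i))
    entries (suc i) (suc j) = refl

  border-split : ∀ {n} (D : Mat (suc n)) a u v (X : Mat n) →
                 border (D zero zero - a) (λ j → D zero (suc j) - u j) (λ i → D (suc i) zero - v i) X
                   +M border a u v (λ i j → - X i j + D (suc i) (suc j)) ≋ D
  border-split D a u v X zero    zero    = //-rightDividesˡ a (D zero zero)
  border-split D a u v X zero    (suc j) = //-rightDividesˡ (u j) (D zero (suc j))
  border-split D a u v X (suc i) zero    = //-rightDividesˡ (v i) (D (suc i) zero)
  border-split D a u v X (suc i) (suc j) = \\-leftDividesˡ (X i j) (D (suc i) (suc j))

  isSumOfSL-fromBlocks : ∀ {n} → (∀ (Y : Mat (suc n)) → IsBlockOfSLSum Y) →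
                         (D : Mat (suc (suc n))) → IsSumOfSL D
  isSumOfSL-fromBlocks blocks D =
    let (a , u , v , K) = blocks (λ i j → - W i j + D (suc i) (suc j))
    in  resp (border-split D a u v W) (isSumOfSL-border-W _ _ _ ⊞ K)

  isSumOfSL : ∀ n (D : Mat (suc (suc n))) → IsSumOfSL D
  isSumOfSL zero    = isSumOfSL-fromBlocks isBlockOfSLSum-1
  isSumOfSL (suc n) = isSumOfSL-fromBlocks λ Y →
    let (e , K) = isSumOfSL-blockDiag (isSumOfSL n Y) in e , 0ᵥ , 0ᵥ , K

  cayleyConnected : ∀ n → CayleyConnected (suc (suc n))
  cayleyConnected n A B =
    walk (isSumOfSL n (A -M B)) (λ i j → sym (//-rightDividesˡ (B i j) (A i j)))

mainTheorem11 : ∀ {c ℓ} (F : CommutativeRing c ℓ) → IsField F → IsFinite F →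
                  (n : ℕ) → n ≥ 2 →
                  MatrixDefs.InSL F (MatrixDefs.negI F {n}) →
                  MatrixDefs.CayleyConnected F n
mainTheorem11 F _ _ (suc (suc m)) (s≤s (s≤s z≤n)) _ = cayleyConnected F m
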